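{- Let $\varphi=\bigwedge_{r\in R}\forall x_1(\alpha_r\to\exists_{[n_r^{+p_r}]}x_2\,\gamma_r)\wedge\bigwedge_{t\in T}\forall x_1(\beta_t\to\neg\exists_{[n_t^{+p_t}]}x_2\,\delta_t)$ be a normal-form $\mathcal{FL}^2_{\text{PC}}$-sentence over $\sigma\cup\{=\}$, and let $\Psi=\Psi_1\cup\dots\cup\Psi_6$ be the system of (disjunctive) linear Diophantine inequations over $\mathbb{N}^*$ associated with $\varphi$ as described in the context. If $\Psi$ has a solution over $\mathbb{N}^*$, then $\varphi$ has a globally homogeneous model.
   Context: Fluted fragment with periodic counting ($\mathcal{FL}_{\text{PC}}$): variables $x_1,x_2$; signature finite relational $\sigma$ plus equality; $n^{+p}=\{n+ip:i\in\mathbb{N}\}$; $\mathfrak{A},a\models\exists_{[n^{+p}]}x_2\varphi$ iff $|\{b:\mathfrak{A},ab\models\varphi\}|$ is finite and in $n^{+p}$. Formulas of $\mathcal{FL}^{[1]}_{\text{PC}}$ quantifier-free: Boolean combinations of $p(x_1)$, $p$ unary; of $\mathcal{FL}^{[2]}_{\text{PC}}$ quantifier-free: Boolean combinations of $p(x_2)$ ($p$ unary) and $r(x_1,x_2)$ ($r\in\sigma\cup\{=\}$ binary); $\alpha_r,\beta_t$ are of the first kind and $\gamma_r,\delta_t$ of the second. $\mathrm{FTP}_1$ is the set of fluted 1-types: sets containing, for each unary $p\in\sigma$, exactly one of $p(x_1),\neg p(x_1)$. $\mathrm{FTP}_2$ is the set of fluted 2-types: sets containing exactly one of each atom/negation of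 the forms $p(x_2)$ ($p$ unary) and $r(x_1,x_2)$ ($r\in\sigma\cup\{=\}$ binary). For $\tau\in\mathrm{FTP}_2$, $\tau\restriction_{[2,2]}\in\mathrm{FTP}_1$ is obtained by keeping the unary literals of $\tau$ and renaming $x_2$ to $x_1$. Types are identified with conjunctions of their members; ${=}\in\tau$ means $x_1=x_2\in\tau$. A structure is globally homogeneous if any two elements with the same fluted 1-type emit, for each $\tau\in\mathrm{FTP}_2$, the same number of $c$ such that the pair has fluted 2-type $\tau$. Arithmetic on $\mathbb{N}^*=\mathbb{N}\cup\{\aleph_0\}$: $\aleph_0$ is the maximum, $0\cdot\aleph_0=0$, $n+\aleph_0=\aleph_0$, $n\cdot\aleph_0=\aleph_0$ for $n\ne0$. Variables: $x_\pi$ ($\pi\in\mathrm{FTP}_1$), $y_{\pi,\tau}$ ($\pi\in\mathrm{FTP}_1,\tau\in\mathrm{FTP}_2$), $i_{\pi,r}$ ($r\in R$), $j_{\pi,t}$ ($t\in T$). $\Psi_1=\{\sum_\pi x_\pi\ge1\}$. $\Psi_2=\{x_\pi\ne0\to\sum_{\tau:\tau\restriction_{[2,2]}=\pi'}y_{\pi,\tau}=x_{\pi'} : \pi,\pi'\in\mathrm{FTP}_1\}$. $\Psi_3=\{x_\pi\ne0\to\sum_{\tau\models\gamma_r}y_{\pi,\tau}=n_r+i_{\pi,r}p_r : r\in R,\ \pi\models\alpha_r\}$. With $\Theta_1(\pi,t):=\sum_{\tau\models\delta_t}y_{\pi,\tau}<n_t$; $\Theta_2(\pi,t):=\sum_{\tau\models\delta_t}y_{\pi,\tau}=\aleph_0$;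 $\Theta_3(\pi,t):=(p_t=0)\wedge(n_t<\sum_{\tau\models\delta_t}y_{\pi,\tau})$; $\Theta_4(\pi,t):=n_t+j_{\pi,t}p_t<\sum_{\tau\models\delta_t}y_{\pi,\tau}<n_t+(j_{\pi,t}+1)p_t$, let $\Psi_4=\{x_\pi\ne0\to\bigvee_{k=1}^4\Theta_k(\pi,t): t\in T,\ \pi\models\beta_t\}$. $\Psi_5=\{y_{\pi,\tau}=0 : {=}\in\tau,\ \tau\restriction_{[2,2]}\ne\pi\}\cup\{\sum_{\tau:{=}\in\tau}y_{\pi,\tau}=1:\pi\in\mathrm{FTP}_1\}$. $\Psi_6=\{i_{\pi,r}<\aleph_0,\ j_{\pi,t}<\aleph_0 : \pi\in\mathrm{FTP}_1, r\in R,t\in T\}$. A solution is an assignment of values in $\mathbb{N}^*$ to all variables satisfying every (conditional/disjunctive) inequation. -}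

module Defs where

open import Data.Nat using (ℕ; zero; suc; _+_; _*_)
import Data.Nat as N
open import Data.Bool using (Bool; true; false; not; _∧_; _∨_; if_then_else_)
import Data.Bool.Properties as BoolP
open import Data.Fin using (Fin)
open import Data.Vec using (Vec; []; _∷_; tabulate)
import Data.Vec.Properties as VecP
open import Data.List using (List; []; _∷_; map; concatMap; _++_)
open import Data.Product using (Σ; Σ-syntax; _×_; _,_)
open import Data.Sum using (_⊎_)
open import Relation.Binary.PropositionalEquality using (_≡_; _≢_)
open import Relation.Binary using (DecidableEquality)
open import Relation.Nullary using (¬_; does)
open import Function.Bundles using (_↔_)

-- Signature σ: U unary predicate symbols and B binary predicate symbols
-- (indexed by Fin U and Fin B), plus equality.

-- First kind: Boolean combinations of p(x₁), p unary.
data Form1 (U : ℕ) : Set where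
  atom  : Fin U → Form1 U
  ⊤f    : Form1 U
  ¬f_   : Form1 U → Form1 U
  _∧f_  : Form1 U → Form1 U → Form1 U
  _∨f_  : Form1 U → Form1 U → Form1 U

-- Second kind: Boolean combinations of p(x₂) (p unary) and
-- r(x₁,x₂) (r binary, or equality).
data Form2 (U B : ℕ) : Set where
  uatom : Fin U → Form2 U B
  batom : Fin B → Form2 U B
  eqatom : Form2 U B
  ⊤f    : Form2 U B
  ¬f_   : Form2 U B → Form2 U B
  _∧f_  : Form2 U B → Form2 U B → Form2 U B
  _∨f_  : Form2 U B → Form2 U B → Form2 U B

record Conjunct (U B : ℕ) : Set where
  field
    n    : ℕ
    p    : ℕ
    pre  : Form1 U
    body : Form2 U B

record NormalForm (U B : ℕ) : Set where
  field
    nR : ℕ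
    R  : Fin nR → Conjunct U B
    nT : ℕ
    T  : Fin nT → Conjunct U B

record Structure (U B : ℕ) : Set₁ where
  field
    Carrier : Set
    _≟_     : DecidableEquality Carrier
    unary   : Fin U → Carrier → Bool
    binary  : Fin B → Carrier → Carrier → Bool

module _ {U B : ℕ} (M : Structure U B) where
  open Structure M

  holds1 : Form1 U → Carrier → Bool
  holds1 (atom p) a = unary p a
  holds1 ⊤f a = true
  holds1 (¬f φ) a = not (holds1 φ a)
  holds1 (φ ∧f ψ) a = holds1 φ a ∧ holds1 ψ a
  holds1 (φ ∨f ψ) a = holds1 φ a ∨ holds1 ψ a

  holds2 : Form2 U B → Carrier → Carrier → Bool
  holds2 (uatom p) a b = unary p b
  holds2 (batom r) a b = binary r a b
  holds2 eqatom a b = does (a ≟ b)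
  holds2 ⊤f a b = true
  holds2 (¬f φ) a b = not (holds2 φ a b)
  holds2 (φ ∧f ψ) a b = holds2 φ a b ∧ holds2 ψ a b
  holds2 (φ ∨f ψ) a b = holds2 φ a b ∨ holds2 ψ a b

  -- |{b : 𝔄,ab ⊨ γ}| is finite and lies in n^{+p} = {n + i p : i ∈ ℕ}
  CountIn : Form2 U B → Carrier → ℕ → ℕ → Set
  CountIn γ a n p =
    Σ[ k ∈ ℕ ] ((Σ[ b ∈ Carrier ] holds2 γ a b ≡ true) ↔ Fin k)
             × (Σ[ i ∈ ℕ ] k ≡ n + i * p)

  Satisfies : NormalForm U B → Set
  Satisfies φ =
    (∀ r a → holds1 (Conjunct.pre (NormalForm.R φ r)) a ≡ true →
       CountIn (Conjunct.body (NormalForm.R φ r)) a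
               (Conjunct.n (NormalForm.R φ r)) (Conjunct.p (NormalForm.R φ r)))
    × (∀ t a → holds1 (Conjunct.pre (NormalForm.T φ t)) a ≡ true →
       ¬ CountIn (Conjunct.body (NormalForm.T φ t)) a
                 (Conjunct.n (NormalForm.T φ t)) (Conjunct.p (NormalForm.T φ t)))

FTP1 : ℕ → Set
FTP1 U = Vec Bool U            -- truth value of p(x₁) for each unary p

FTP2 : ℕ → ℕ → Set
FTP2 U B = Vec Bool U × Vec Bool B × Bool
  -- (truth of p(x₂) per unary p, truth of r(x₁,x₂) per binary r, truth of x₁ = x₂)

restr : ∀ {U B} → FTP2 U B → FTP1 U
restr (u , _ , _) = u

eqIn : ∀ {U B} → FTP2 U B → Bool
eqIn (_ , _ , e) = e

lookupB : ∀ {n} → Vec Bool n → Fin n → Bool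
lookupB = Data.Vec.lookup

-- π ⊨ α  (π identified with the conjunction of its members)
sat1 : ∀ {U} → FTP1 U → Form1 U → Bool
sat1 π (atom p) = lookupB π p
sat1 π ⊤f = true
sat1 π (¬f φ) = not (sat1 π φ)
sat1 π (φ ∧f ψ) = sat1 π φ ∧ sat1 π ψ
sat1 π (φ ∨f ψ) = sat1 π φ ∨ sat1 π ψ

sat2 : ∀ {U B} → FTP2 U B → Form2 U B → Bool
sat2 (u , b , e) (uatom p) = lookupB u p
sat2 (u , b , e) (batom r) = lookupB b r
sat2 (u , b , e) eqatom = e
sat2 τ ⊤f = true
sat2 τ (¬f φ) = not (sat2 τ φ)
sat2 τ (φ ∧f ψ) = sat2 τ φ ∧ sat2 τ ψ
sat2 τ (φ ∨f ψ) = sat2 τ φ ∨ sat2 τ ψ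

allVecs : (n : ℕ) → List (Vec Bool n)
allVecs zero = [] ∷ []
allVecs (suc n) = map (true ∷_) (allVecs n) ++ map (false ∷_) (allVecs n)

allFTP1 : (U : ℕ) → List (FTP1 U)
allFTP1 = allVecs

allFTP2 : (U B : ℕ) → List (FTP2 U B)
allFTP2 U B =
  concatMap (λ u → concatMap (λ b → (u , b , true) ∷ (u , b , false) ∷ [])
                             (allVecs B))
            (allVecs U)

_==₁_ : ∀ {U} → FTP1 U → FTP1 U → Bool
π ==₁ π' = does (VecP.≡-dec BoolP._≟_ π π')

module _ {U B : ℕ} (M : Structure U B) where
  open Structure M

  tp1 : Carrier → FTP1 U
  tp1 a = tabulate (λ p → unary p a)

  tp2 : Carrier → Carrier → FTP2 U B
  tp2 a c = tabulate (λ p → unary p c) , tabulate (λ r → binary r a c) , does (a ≟ c)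

  GloballyHomogeneous : Set
  GloballyHomogeneous =
    ∀ a a' → tp1 a ≡ tp1 a' → ∀ (τ : FTP2 U B) →
      (Σ[ c ∈ Carrier ] tp2 a c ≡ τ) ↔ (Σ[ c ∈ Carrier ] tp2 a' c ≡ τ)

data ℕ* : Set where
  fin : ℕ → ℕ*
  ℵ₀  : ℕ*

_+*_ : ℕ* → ℕ* → ℕ*
fin m +* fin n = fin (m + n)
fin _ +* ℵ₀ = ℵ₀
ℵ₀ +* _ = ℵ₀

_·*_ : ℕ* → ℕ* → ℕ*
fin zero ·* _ = fin zero
fin (suc m) ·* fin n = fin (suc m * n)
fin (suc m) ·* ℵ₀ = ℵ₀
ℵ₀ ·* fin zero = fin zero
ℵ₀ ·* fin (suc _) = ℵ₀
ℵ₀ ·* ℵ₀ = ℵ₀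

infixl 6 _+*_
infixl 7 _·*_
infix 4 _<*_ _≤*_

data _<*_ : ℕ* → ℕ* → Set where
  fin<fin : ∀ {m n} → m N.< n → fin m <* fin n
  fin<ℵ₀  : ∀ {m} → fin m <* ℵ₀

data _≤*_ : ℕ* → ℕ* → Set where
  fin≤fin : ∀ {m n} → m N.≤ n → fin m ≤* fin n
  ≤ℵ₀     : ∀ {m} → m ≤* ℵ₀

sumWhere : ∀ {A : Set} → List A → (A → Bool) → (A → ℕ*) → ℕ*
sumWhere [] c f = fin 0
sumWhere (a ∷ as) c f = (if c a then f a else fin 0) +* sumWhere as c f

record Solution {U B : ℕ} (φ : NormalForm U B) : Set where
  open NormalForm φ
  open Conjunct
  field
    x : FTP1 U → ℕ*
    y : FTP1 U → FTP2 U B → ℕ*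
    i : FTP1 U → Fin nR → ℕ*
    j : FTP1 U → Fin nT → ℕ*

  Sγ : FTP1 U → Form2 U B → ℕ*
  Sγ π γ = sumWhere (allFTP2 U B) (λ τ → sat2 τ γ) (y π)

  Θ : FTP1 U → Fin nT → Set
  Θ π t =
      (Sγ π (body (T t)) <* fin (n (T t)))
    ⊎ (Sγ π (body (T t)) ≡ ℵ₀)
    ⊎ ((p (T t) ≡ 0) × (fin (n (T t)) <* Sγ π (body (T t))))
    ⊎ ((fin (n (T t)) +* j π t ·* fin (p (T t)) <* Sγ π (body (T t)))
       × (Sγ π (body (T t)) <* fin (n (T t)) +* (j π t +* fin 1) ·* fin (p (T t))))

  field
    Ψ₁ : fin 1 ≤* sumWhere (allFTP1 U) (λ _ → true) x
    Ψ₂ : ∀ (π π' : FTP1 U) → x π ≢ fin 0 →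
           sumWhere (allFTP2 U B) (λ τ → restr τ ==₁ π') (y π) ≡ x π'
    Ψ₃ : ∀ (r : Fin nR) (π : FTP1 U) → sat1 π (pre (R r)) ≡ true → x π ≢ fin 0 →
           Sγ π (body (R r)) ≡ fin (n (R r)) +* i π r ·* fin (p (R r))
    Ψ₄ : ∀ (t : Fin nT) (π : FTP1 U) → sat1 π (pre (T t)) ≡ true → x π ≢ fin 0 →
           Θ π t
    Ψ₅a : ∀ (π : FTP1 U) (τ : FTP2 U B) → eqIn τ ≡ true → restr τ ≢ π → y π τ ≡ fin 0
    Ψ₅b : ∀ (π : FTP1 U) → sumWhere (allFTP2 U B) eqIn (y π) ≡ fin 1
    Ψ₆i : ∀ (π : FTP1 U) (r : Fin nR) → i π r <* ℵ₀
    Ψ₆j : ∀ (π : FTP1 U) (t : Fin nT) → j π t <* ℵ₀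

-- Let the universe consist, for each fluted 1-type π, of x_π elements of type π (ℵ₀ read as ℕ).
-- For a realised π, lay out y_{π,τ} slots labelled τ for every fluted 2-type τ. By Ψ₂ the slots
-- whose label has second component π′ are exactly x_{π′} many, so the universe is in bijection
-- with the slots, the element c going to a slot whose label has second component tp(c). By Ψ₅
-- exactly one slot carries =, and its second component is π; composing with a transposition we
-- may send a itself to that slot. Reading the binary relations between a and c off the label of
-- c's slot gives a structure in which tp(a,c) is that label, so the number of c with a,c ⊨ γ is
-- Σ_{τ ⊨ γ} y_{π,τ}; Ψ₃, Ψ₄ and Ψ₆ turn this into the counting conjuncts, and since the slot
-- layout depends only on π the structure is globally homogeneous.

module Submission where

open import Defs
open import Data.Nat as ℕ using (ℕ; zero; suc; _+_; _*_; _≤_; _<_)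
import Data.Nat.Properties as ℕₚ
open import Data.Bool using (Bool; true; false; not; _∧_; _∨_; if_then_else_)
import Data.Bool.Properties as Boolₚ
open import Data.Vec using (lookup)
import Data.Vec.Properties as Vecₚ
open import Data.Fin using (Fin; zero; suc; toℕ)
import Data.Fin.Properties as Finₚ
open import Data.Fin.Permutation using (↔⇒≡)
open import Data.List using (List; []; _∷_)
open import Data.List.Relation.Unary.Any using (Any)
open import Data.List.Relation.Unary.Any.Properties using (∷↔)
open import Data.List.Membership.Propositional using (_∈_)
open import Data.List.Membership.Propositional.Properties.Core using (Any↔)
open import Data.Product using (Σ; Σ-syntax; ∃; _×_; _,_; proj₁; proj₂)
import Data.Product.Properties as Productₚ
open import Data.Product.Function.Dependent.Propositional using (Σ-↔)
open import Data.Sum using (_⊎_; inj₁; inj₂; [_,_])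
import Data.Sum as Sum
open import Data.Sum.Function.Propositional using (_⊎-↔_)
open import Data.Sum.Algebra using (⊎-comm)
open import Data.Unit using (⊤)
open import Data.Empty using (⊥-elim)
open import Function.Base using (_∘_)
open import Function.Bundles using (_↔_; Inverse; mk↔ₛ′)
open import Function.Properties.Inverse using (↔-refl; ↔-sym; ↔-trans)
open import Function.Related.Propositional using (module EquationalReasoning)
open import Relation.Binary using (DecidableEquality)
open import Relation.Binary.PropositionalEquality
  using (_≡_; _≢_; refl; sym; trans; cong; cong₂; subst; module ≡-Reasoning)
open import Relation.Nullary using (¬_; Dec; yes; no; does)
open import Relation.Nullary.Decidable using (decidable-stable; dec-true; dec-false)
open import Relation.Nullary.Negation using (contradiction)
open import Axiom.UniquenessOfIdentityProofs.WithK using (uip)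

Fibre : {A X : Set} → (A → X) → X → Set
Fibre {A} t x = Σ[ a ∈ A ] t a ≡ x

≡ˡ-↔ : {X : Set} {x y z : X} → x ≡ y → (x ≡ z) ↔ (y ≡ z)
≡ˡ-↔ refl = ↔-refl

-- Callers pass t and u explicitly: inferring them unfolds f, which is prohibitively slow.
fibre-↔ : {A S X : Set} {t : A → X} {u : S → X} (f : A ↔ S) →
          (∀ a → t a ≡ u (Inverse.to f a)) → ∀ x → Fibre t x ↔ Fibre u x
fibre-↔ f t≡u∘f x = Σ-↔ f (≡ˡ-↔ (t≡u∘f _))

module _ {B S : Set} {F : B → Set} (g : S → B) (h : ∀ b → F b ↔ Fibre g b) where

  Σ-fibres-↔ : Σ B F ↔ S
  Σ-fibres-↔ = mk↔ₛ′ (λ (b , v) → proj₁ (Inverse.to (h b) v))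
                     (λ s → g s , Inverse.from (h (g s)) (s , refl))
                     (λ s → cong proj₁ (Inverse.strictlyInverseˡ (h (g s)) (s , refl)))
                     from∘to
    where
    from∘to : ∀ c → (g (proj₁ (Inverse.to (h (proj₁ c)) (proj₂ c))) ,
                     Inverse.from (h _) (proj₁ (Inverse.to (h (proj₁ c)) (proj₂ c)) , refl)) ≡ c
    from∘to (b , v) with Inverse.to (h b) v | Inverse.strictlyInverseʳ (h b) v
    ... | s , refl | from∘to≡v = cong (g s ,_) from∘to≡v

  Σ-fibres-↔-over : ∀ c → g (Inverse.to Σ-fibres-↔ c) ≡ proj₁ c
  Σ-fibres-↔-over (b , v) = proj₂ (Inverse.to (h b) v)

does≡true↔ : {P : Set} (d : Dec P) → (∀ (p q : P) → p ≡ q) → (does d ≡ true) ↔ P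
does≡true↔ (yes p) irr = mk↔ₛ′ (λ _ → p) (λ _ → refl) (irr p) (λ { refl → refl })
does≡true↔ (no ¬p) irr = mk↔ₛ′ (λ ()) (⊥-elim ∘ ¬p) (⊥-elim ∘ ¬p) (λ ())

↔⊤⇒≡ : {A : Set} → A ↔ ⊤ → (a a' : A) → a ≡ a'
↔⊤⇒≡ f a a' = trans (sym (Inverse.strictlyInverseʳ f a)) (Inverse.strictlyInverseʳ f a')

↔-injective : {A B : Set} (f : A ↔ B) {a a' : A} → Inverse.to f a ≡ Inverse.to f a' → a ≡ a'
↔-injective f {a} {a'} eq = begin
  a                                 ≡⟨ sym (Inverse.strictlyInverseʳ f a) ⟩
  Inverse.from f (Inverse.to f a)   ≡⟨ cong (Inverse.from f) eq ⟩
  Inverse.from f (Inverse.to f a')  ≡⟨ Inverse.strictlyInverseʳ f a' ⟩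
  a'                                ∎
  where open ≡-Reasoning

≡does : {P : Set} (b : Bool) (d : Dec P) → (b ≡ true → P) → (P → b ≡ true) → b ≡ does d
≡does true  d b⇒P _   = sym (dec-true d (b⇒P refl))
≡does false d _   P⇒b = sym (dec-false d λ p → contradiction (P⇒b p) λ ())

module Transposition {C : Set} (_≟_ : DecidableEquality C) (u v : C) where

  transpose : C → C
  transpose w with w ≟ u
  ... | yes _ = v
  ... | no _ with w ≟ v
  ...   | yes _ = u
  ...   | no _  = w

  transpose-u : transpose u ≡ v
  transpose-u with u ≟ u
  ... | yes _  = refl
  ... | no u≢u = ⊥-elim (u≢u refl)

  transpose-v : transpose v ≡ u
  transpose-v with v ≟ u
  ... | yes v≡u = v≡u
  ... | no _ with v ≟ v
  ...   | yes _  = refl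
  ...   | no v≢v = ⊥-elim (v≢v refl)

  transpose-fixed : ∀ {w} → w ≢ u → w ≢ v → transpose w ≡ w
  transpose-fixed {w} w≢u w≢v with w ≟ u
  ... | yes w≡u = ⊥-elim (w≢u w≡u)
  ... | no _ with w ≟ v
  ...   | yes w≡v = ⊥-elim (w≢v w≡v)
  ...   | no _    = refl

  transpose-involutive : ∀ w → transpose (transpose w) ≡ w
  transpose-involutive w with w ≟ u
  ... | yes refl = transpose-v
  ... | no w≢u with w ≟ v
  ...   | yes refl = transpose-u
  ...   | no w≢v   = transpose-fixed w≢u w≢v

  transpose-↔ : C ↔ C
  transpose-↔ = mk↔ₛ′ transpose transpose transpose-involutive transpose-involutive

  transpose-preserves : {X : Set} (t : C → X) → t u ≡ t v → ∀ w → t (transpose w) ≡ t w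
  transpose-preserves t tu≡tv w with w ≟ u
  ... | yes refl = sym tu≡tv
  ... | no _ with w ≟ v
  ...   | yes refl = tu≡tv
  ...   | no _     = refl

El : ℕ* → Set
El (fin n) = Fin n
El ℵ₀      = ℕ

El-≟ : ∀ a → DecidableEquality (El a)
El-≟ (fin n) = Finₚ._≟_
El-≟ ℵ₀      = ℕₚ._≟_

ℕ↔Fin⊎ℕ : ∀ m → ℕ ↔ (Fin m ⊎ ℕ)
ℕ↔Fin⊎ℕ m = mk↔ₛ′ (split m) [ toℕ , m +_ ] (split-join m) (join-split m)
  where
  split : ∀ m → ℕ → Fin m ⊎ ℕ
  split zero    n       = inj₂ n
  split (suc m) zero    = inj₁ zero
  split (suc m) (suc n) = Sum.map₁ suc (split m n)

  split-join : ∀ m s → split m ([ toℕ , m +_ ] s) ≡ s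
  split-join zero    (inj₂ n)       = refl
  split-join (suc m) (inj₁ zero)    = refl
  split-join (suc m) (inj₁ (suc i)) = cong (Sum.map₁ suc) (split-join m (inj₁ i))
  split-join (suc m) (inj₂ n)       = cong (Sum.map₁ suc) (split-join m (inj₂ n))

  join-split : ∀ m n → [ toℕ , m +_ ] (split m n) ≡ n
  join-split zero    n       = refl
  join-split (suc m) zero    = refl
  join-split (suc m) (suc n) with split m n | join-split m n
  ... | inj₁ i | eq = cong suc eq
  ... | inj₂ k | eq = cong suc eq

ℕ↔ℕ⊎ℕ : ℕ ↔ (ℕ ⊎ ℕ)
ℕ↔ℕ⊎ℕ = mk↔ₛ′ unzip zip unzip-zip zip-unzip
  where
  unzip : ℕ → ℕ ⊎ ℕ
  unzip zero          = inj₁ zero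
  unzip (suc zero)    = inj₂ zero
  unzip (suc (suc n)) = Sum.map ℕ.suc ℕ.suc (unzip n)

  zip : ℕ ⊎ ℕ → ℕ
  zip (inj₁ zero)    = zero
  zip (inj₂ zero)    = suc zero
  zip (inj₁ (suc n)) = suc (suc (zip (inj₁ n)))
  zip (inj₂ (suc n)) = suc (suc (zip (inj₂ n)))

  unzip-zip : ∀ s → unzip (zip s) ≡ s
  unzip-zip (inj₁ zero)    = refl
  unzip-zip (inj₂ zero)    = refl
  unzip-zip (inj₁ (suc n)) = cong (Sum.map ℕ.suc ℕ.suc) (unzip-zip (inj₁ n))
  unzip-zip (inj₂ (suc n)) = cong (Sum.map ℕ.suc ℕ.suc) (unzip-zip (inj₂ n))

  zip-unzip : ∀ n → zip (unzip n) ≡ n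
  zip-unzip zero          = refl
  zip-unzip (suc zero)    = refl
  zip-unzip (suc (suc n)) with unzip n | zip-unzip n
  ... | inj₁ k | eq = cong (ℕ.suc ∘ ℕ.suc) eq
  ... | inj₂ k | eq = cong (ℕ.suc ∘ ℕ.suc) eq

El-+* : ∀ a b → El (a +* b) ↔ (El a ⊎ El b)
El-+* (fin m) (fin n) = Finₚ.+↔⊎
El-+* (fin m) ℵ₀      = ℕ↔Fin⊎ℕ m
El-+* ℵ₀      (fin n) = ↔-trans (ℕ↔Fin⊎ℕ n) (⊎-comm _ _)
El-+* ℵ₀      ℵ₀      = ℕ↔ℕ⊎ℕ

El-if : ∀ c a → El (if c then a else fin 0) ↔ (c ≡ true × El a)
El-if true  a = mk↔ₛ′ (refl ,_) proj₂ (λ { (refl , _) → refl }) (λ _ → refl)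
El-if false a = mk↔ₛ′ (λ ()) (λ { (() , _) }) (λ { (() , _) }) (λ ())

module _ {A : Set} (c : A → Bool) (f : A → ℕ*) where

  El-sumWhere-Any : ∀ xs → El (sumWhere xs c f) ↔ Any (λ a → c a ≡ true × El (f a)) xs
  El-sumWhere-Any []       = mk↔ₛ′ (λ ()) (λ ()) (λ ()) (λ ())
  El-sumWhere-Any (a ∷ xs) = begin
    El (sumWhere (a ∷ xs) c f)
      ↔⟨ El-+* (if c a then f a else fin 0) _ ⟩
    (El (if c a then f a else fin 0) ⊎ El (sumWhere xs c f))
      ↔⟨ El-if (c a) (f a) ⊎-↔ El-sumWhere-Any xs ⟩
    ((c a ≡ true × El (f a)) ⊎ Any _ xs)
      ↔⟨ ∷↔ _ ⟩
    Any _ (a ∷ xs) ∎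
    where open EquationalReasoning

-- A list xs weighted by f: f a copies of each entry a (one block per occurrence of a in xs).
Copies : {A : Set} → List A → (A → ℕ*) → Set
Copies xs f = ∃ λ a → a ∈ xs × El (f a)

El-sumWhere : ∀ {A : Set} xs (c : A → Bool) f → El (sumWhere xs c f) ↔ (Σ[ s ∈ Copies xs f ] c (proj₁ s) ≡ true)
El-sumWhere xs c f = ↔-trans (El-sumWhere-Any c f xs) (↔-trans (↔-sym Any↔) reassoc)
  where
  reassoc : (∃ λ a → a ∈ xs × (c a ≡ true × El (f a))) ↔ (Σ[ s ∈ Copies xs f ] c (proj₁ s) ≡ true)
  reassoc = mk↔ₛ′ (λ { (a , a∈ , ca , e) → (a , a∈ , e) , ca }) (λ { ((a , a∈ , e) , ca) → a , a∈ , ca , e })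
                  (λ _ → refl) (λ _ → refl)

El-cong : ∀ {a b} → a ≡ b → El a ↔ El b
El-cong refl = ↔-refl

¬ℕ↔Fin : ∀ k → ¬ (ℕ ↔ Fin k)
¬ℕ↔Fin k f with Finₚ.pigeonhole (ℕₚ.n<1+n k) (Inverse.to f ∘ toℕ)
... | i , j , i<j , eq = ℕₚ.<-irrefl (↔-injective f eq) i<j

El↔Fin⇒≡fin : ∀ a {k} → El a ↔ Fin k → a ≡ fin k
El↔Fin⇒≡fin (fin m) f = cong fin (↔⇒≡ f)
El↔Fin⇒≡fin ℵ₀      f = ⊥-elim (¬ℕ↔Fin _ f)

fin·fin : ∀ m n → fin m ·* fin n ≡ fin (m * n)
fin·fin zero    n = refl
fin·fin (suc m) n = refl

-- Θ₁ ∨ Θ₂ ∨ Θ₃ ∨ Θ₄ of Ψ₄, for the count S and the index J = j_{π,t}.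
AvoidsProgression : ℕ* → ℕ → ℕ → ℕ* → Set
AvoidsProgression S n p J =
    (S <* fin n)
  ⊎ (S ≡ ℵ₀)
  ⊎ ((p ≡ 0) × (fin n <* S))
  ⊎ ((fin n +* J ·* fin p <* S) × (S <* fin n +* (J +* fin 1) ·* fin p))

inProgression⇒¬avoids : ∀ n p i j → ¬ AvoidsProgression (fin (n + i * p)) n p (fin j)
inProgression⇒¬avoids n p i j (inj₁ (fin<fin n+ip<n)) = ℕₚ.m+n≮m n (i * p) n+ip<n
inProgression⇒¬avoids n p i j (inj₂ (inj₁ ()))
inProgression⇒¬avoids n p i j (inj₂ (inj₂ (inj₁ (refl , fin<fin n<n+i0)))) =
  ℕₚ.<-irrefl (sym (trans (cong (n +_) (ℕₚ.*-zeroʳ i)) (ℕₚ.+-identityʳ n))) n<n+i0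
inProgression⇒¬avoids n p i j (inj₂ (inj₂ (inj₂ (lower , upper))))
  rewrite fin·fin j p | fin·fin (j + 1) p with lower | upper
... | fin<fin n+jp<n+ip | fin<fin n+ip<n+[j+1]p = ℕₚ.<⇒≱ i<j+1 (subst (_≤ i) (ℕₚ.+-comm 1 j) j<i)
  where
  j<i : j < i
  j<i = ℕₚ.*-cancelʳ-< p j i (ℕₚ.+-cancelˡ-< n (j * p) (i * p) n+jp<n+ip)
  i<j+1 : i < j + 1
  i<j+1 = ℕₚ.*-cancelʳ-< p i (j + 1) (ℕₚ.+-cancelˡ-< n (i * p) ((j + 1) * p) n+ip<n+[j+1]p)

module _ {U B : ℕ} (M : Structure U B) where

  holds1≡sat1∘tp1 : ∀ α a → holds1 M α a ≡ sat1 (tp1 M a) α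
  holds1≡sat1∘tp1 (atom p) a = sym (Vecₚ.lookup∘tabulate _ p)
  holds1≡sat1∘tp1 ⊤f       a = refl
  holds1≡sat1∘tp1 (¬f α)   a = cong not (holds1≡sat1∘tp1 α a)
  holds1≡sat1∘tp1 (α ∧f β) a = cong₂ _∧_ (holds1≡sat1∘tp1 α a) (holds1≡sat1∘tp1 β a)
  holds1≡sat1∘tp1 (α ∨f β) a = cong₂ _∨_ (holds1≡sat1∘tp1 α a) (holds1≡sat1∘tp1 β a)

  holds2≡sat2∘tp2 : ∀ γ a c → holds2 M γ a c ≡ sat2 (tp2 M a c) γ
  holds2≡sat2∘tp2 (uatom p) a c = sym (Vecₚ.lookup∘tabulate _ p)
  holds2≡sat2∘tp2 (batom r) a c = sym (Vecₚ.lookup∘tabulate _ r)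
  holds2≡sat2∘tp2 eqatom    a c = refl
  holds2≡sat2∘tp2 ⊤f        a c = refl
  holds2≡sat2∘tp2 (¬f γ)    a c = cong not (holds2≡sat2∘tp2 γ a c)
  holds2≡sat2∘tp2 (γ ∧f δ)  a c = cong₂ _∧_ (holds2≡sat2∘tp2 γ a c) (holds2≡sat2∘tp2 δ a c)
  holds2≡sat2∘tp2 (γ ∨f δ)  a c = cong₂ _∨_ (holds2≡sat2∘tp2 γ a c) (holds2≡sat2∘tp2 δ a c)

module Model {U B : ℕ} (φ : NormalForm U B) (sol : Solution φ) where
  open NormalForm φ
  open Conjunct
  open Solution sol

  Element : Set
  Element = Σ (FTP1 U) (El ∘ x)

  _≟₁_ : DecidableEquality (FTP1 U)
  _≟₁_ = Vecₚ.≡-dec Boolₚ._≟_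

  _≟ₑ_ : DecidableEquality Element
  _≟ₑ_ = Productₚ.≡-dec _≟₁_ (El-≟ _)

  realised : (a : Element) → x (proj₁ a) ≢ fin 0
  realised (π , e) x≡0 = Finₚ.¬Fin0 (subst El x≡0 e)

  -- The slots of the proof idea: y_{π,τ} copies of each fluted 2-type τ, labelled by τ.
  Slots : FTP1 U → Set
  Slots π = Copies (allFTP2 U B) (y π)

  label : ∀ {π} → Slots π → FTP2 U B
  label = proj₁

  module _ (π : FTP1 U) (π-realised : x π ≢ fin 0) where

    El-x↔Slots-over : ∀ π' → El (x π') ↔ Fibre (restr ∘ label {π}) π'
    El-x↔Slots-over π' = begin
      El (x π')
        ≡⟨ cong El (sym (Ψ₂ π π' π-realised)) ⟩
      El (sumWhere (allFTP2 U B) (λ τ → restr τ ==₁ π') (y π))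
        ↔⟨ El-sumWhere (allFTP2 U B) _ (y π) ⟩
      (Σ[ s ∈ Slots π ] (restr (label s) ==₁ π') ≡ true)
        ↔⟨ Σ-↔ ↔-refl (does≡true↔ (_ ≟₁ π') uip) ⟩
      Fibre (restr ∘ label) π' ∎
      where open EquationalReasoning

    Element↔Slots : Element ↔ Slots π
    Element↔Slots = Σ-fibres-↔ (restr ∘ label) El-x↔Slots-over

    restr-Element↔Slots : ∀ c → restr (label (Inverse.to Element↔Slots c)) ≡ proj₁ c
    restr-Element↔Slots = Σ-fibres-↔-over (restr ∘ label) El-x↔Slots-over

  diagonalSlots↔⊤ : ∀ π → Fibre (eqIn ∘ label {π}) true ↔ ⊤
  diagonalSlots↔⊤ π = begin
    Fibre (eqIn ∘ label) true               ↔⟨ ↔-sym (El-sumWhere (allFTP2 U B) eqIn (y π)) ⟩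
    El (sumWhere (allFTP2 U B) eqIn (y π))  ≡⟨ cong El (Ψ₅b π) ⟩
    Fin 1                                   ↔⟨ Finₚ.1↔⊤ ⟩
    ⊤                                       ∎
    where open EquationalReasoning

  diagonal : ∀ π → Slots π
  diagonal π = proj₁ (Inverse.from (diagonalSlots↔⊤ π) _)

  eqIn-diagonal : ∀ π → eqIn (label (diagonal π)) ≡ true
  eqIn-diagonal π = proj₂ (Inverse.from (diagonalSlots↔⊤ π) _)

  eqIn⇒diagonal : ∀ {π} (s : Slots π) → eqIn (label s) ≡ true → s ≡ diagonal π
  eqIn⇒diagonal {π} s eq = cong proj₁ (↔⊤⇒≡ (diagonalSlots↔⊤ π) (s , eq) (diagonal π , eqIn-diagonal π))

  restr-diagonal : ∀ π → restr (label (diagonal π)) ≡ π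
  restr-diagonal π = decidable-stable (_ ≟₁ π) λ restr≢π →
    Finₚ.¬Fin0 (subst El (Ψ₅a π _ (eqIn-diagonal π) restr≢π) (proj₂ (proj₂ (diagonal π))))

  module _ (a : Element) where
    private
      π = proj₁ a
      E = Element↔Slots π (realised a)
      a* = Inverse.from E (diagonal π)

      proj₁-a* : proj₁ a* ≡ π
      proj₁-a* = begin
        proj₁ a*                                 ≡⟨ sym (restr-Element↔Slots π (realised a) a*) ⟩
        restr (label (Inverse.to E a*))       ≡⟨ cong (restr ∘ label) (Inverse.strictlyInverseˡ E (diagonal π)) ⟩
        restr (label (diagonal π))                ≡⟨ restr-diagonal π ⟩
        π                                        ∎
        where open ≡-Reasoning

    -- a* is the element sent to the diagonal slot; swapping it with a sends a there instead.
    open Transposition _≟ₑ_ a a*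

    slotsFrom : Element ↔ Slots π
    slotsFrom = ↔-trans transpose-↔ E

    slotsFrom-diagonal : Inverse.to slotsFrom a ≡ diagonal π
    slotsFrom-diagonal = trans (cong (Inverse.to E) transpose-u) (Inverse.strictlyInverseˡ E (diagonal π))

    restr-slotsFrom : ∀ c → restr (label (Inverse.to slotsFrom c)) ≡ proj₁ c
    restr-slotsFrom c = trans (restr-Element↔Slots π (realised a) (transpose c))
                              (transpose-preserves proj₁ (sym proj₁-a*) c)

    eqIn-slotsFrom : ∀ c → eqIn (label (Inverse.to slotsFrom c)) ≡ does (a ≟ₑ c)
    eqIn-slotsFrom c = ≡does _ (a ≟ₑ c) eqIn⇒a≡c a≡c⇒eqIn
      where
      eqIn⇒a≡c : eqIn (label (Inverse.to slotsFrom c)) ≡ true → a ≡ c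
      eqIn⇒a≡c eqIn≡true = sym (↔-injective slotsFrom
                               (trans (eqIn⇒diagonal (Inverse.to slotsFrom c) eqIn≡true) (sym slotsFrom-diagonal)))
      a≡c⇒eqIn : a ≡ c → eqIn (label (Inverse.to slotsFrom c)) ≡ true
      a≡c⇒eqIn refl = trans (cong (eqIn ∘ label) slotsFrom-diagonal) (eqIn-diagonal π)

  pairType : Element → Element → FTP2 U B
  pairType a c = label (Inverse.to (slotsFrom a) c)

  M : Structure U B
  M = record
    { Carrier = Element
    ; _≟_     = _≟ₑ_
    ; unary   = λ p c → lookup (proj₁ c) p
    ; binary  = λ r a c → lookup (proj₁ (proj₂ (pairType a c))) r
    }

  tp1-M : ∀ a → tp1 M a ≡ proj₁ a
  tp1-M a = Vecₚ.tabulate∘lookup (proj₁ a)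

  tp2-M : ∀ a c → tp2 M a c ≡ pairType a c
  tp2-M a c = cong₂ _,_ (trans (Vecₚ.tabulate∘lookup (proj₁ c)) (sym (restr-slotsFrom a c)))
                        (cong₂ _,_ (Vecₚ.tabulate∘lookup _) (sym (eqIn-slotsFrom a c)))

  holds1-M : ∀ α a → holds1 M α a ≡ sat1 (proj₁ a) α
  holds1-M α a = trans (holds1≡sat1∘tp1 M α a) (cong (λ π → sat1 π α) (tp1-M a))

  count-M : ∀ a γ → Fibre (holds2 M γ a) true ↔ El (Sγ (proj₁ a) γ)
  count-M a γ = ↔-trans (fibre-↔ {t = holds2 M γ a} {u = λ s → sat2 (label s) γ} (slotsFrom a) holds≡sat true)
                        (↔-sym (El-sumWhere (allFTP2 U B) (λ τ → sat2 τ γ) (y (proj₁ a))))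
    where
    holds≡sat : ∀ c → holds2 M γ a c ≡ sat2 (pairType a c) γ
    holds≡sat c = trans (holds2≡sat2∘tp2 M γ a c) (cong (λ τ → sat2 τ γ) (tp2-M a c))

  positive : ∀ r a → holds1 M (pre (R r)) a ≡ true →
             CountIn M (body (R r)) a (n (R r)) (p (R r))
  positive r a α-holds
    with i (proj₁ a) r | Ψ₆i (proj₁ a) r
       | Ψ₃ r (proj₁ a) (trans (sym (holds1-M (pre (R r)) a)) α-holds) (realised a)
  ... | fin i′ | _ | S≡ = n (R r) + i′ * p (R r) , ↔-trans (count-M a (body (R r))) (El-cong S≡fin) , i′ , refl
    where
    S≡fin : Sγ (proj₁ a) (body (R r)) ≡ fin (n (R r) + i′ * p (R r))
    S≡fin = trans S≡ (cong (fin (n (R r)) +*_) (fin·fin i′ (p (R r))))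

  negative : ∀ t a → holds1 M (pre (T t)) a ≡ true →
             ¬ CountIn M (body (T t)) a (n (T t)) (p (T t))
  negative t a β-holds (k , count↔k , i′ , k≡)
    with j (proj₁ a) t | Ψ₆j (proj₁ a) t
       | Ψ₄ t (proj₁ a) (trans (sym (holds1-M (pre (T t)) a)) β-holds) (realised a)
  ... | fin j′ | _ | avoids =
    inProgression⇒¬avoids (n (T t)) (p (T t)) i′ j′ (subst (λ S → AvoidsProgression S _ _ _) S≡fin avoids)
    where
    S≡fin : Sγ (proj₁ a) (body (T t)) ≡ fin (n (T t) + i′ * p (T t))
    S≡fin = trans (El↔Fin⇒≡fin _ (↔-trans (↔-sym (count-M a (body (T t)))) count↔k)) (cong fin k≡)

  homogeneous : GloballyHomogeneous M
  homogeneous a a' tp≡ τ = begin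
    Fibre (tp2 M a) τ                       ↔⟨ fibre-↔ {t = tp2 M a} {u = label} (slotsFrom a) (tp2-M a) τ ⟩
    Fibre (label {proj₁ a}) τ            ≡⟨ cong (λ π → Fibre (label {π}) τ) π≡π' ⟩
    Fibre (label {proj₁ a'}) τ           ↔⟨ ↔-sym (fibre-↔ {t = tp2 M a'} {u = label} (slotsFrom a') (tp2-M a') τ) ⟩
    Fibre (tp2 M a') τ                      ∎
    where
    open EquationalReasoning
    π≡π' : proj₁ a ≡ proj₁ a'
    π≡π' = trans (sym (tp1-M a)) (trans tp≡ (tp1-M a'))

  someElement : Element
  someElement = proj₁ s , proj₂ (proj₂ s)
    where
    elementOf : ∀ S → fin 1 ≤* S → El S
    elementOf (fin zero)    (fin≤fin ())
    elementOf (fin (suc _)) _ = zero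
    elementOf ℵ₀            _ = zero
    s : Copies (allFTP1 U) x
    s = proj₁ (Inverse.to (El-sumWhere (allFTP1 U) _ x) (elementOf _ Ψ₁))

lemma4 : ∀ {U B : ℕ} (φ : NormalForm U B) → Solution φ →
    Σ[ M ∈ Structure U B ] (Structure.Carrier M × Satisfies M φ × GloballyHomogeneous M)
lemma4 φ sol = M , someElement , (positive , negative) , homogeneous
  where open Model φ sol
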